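{- Let $H_1$ and $H_2$ be finite bipartite graphs with no isolated vertices, and let $H=H_1+H_2$ be their disjoint union, so $|E(H)|=|E(H_1)|+|E(H_2)|$ and $|V(H)|=|V(H_1)|+|V(H_2)|$. (1) If $\min_{e\in E(H_1)}|S_1(e)|<|E(H_1)|-\frac{|V(H_1)|}{2}$, then $\min_{e\in E(H)}|S_1(e)|<|E(H)|-\frac{|V(H)|}{2}$. (2) If $H_2$ is not a disjoint union of $|E(H_2)|$ edges (i.e. $H_2\ne H^1_{|E(H_2)|}$) and $\min_{e\in E(H_1)}|S_1(e)|\le|E(H_1)|-\frac{|V(H_1)|}{2}$, then $\min_{e\in E(H)}|S_1(e)|<|E(H)|-\frac{|V(H)|}{2}$.
   Context: For an edge $e$ of a graph, $S_1(e)$ is the set of edges of that graph different from $e$ sharing an endpoint with $e$. $H^1_n$ denotes the disjoint union of $n$ edges. -}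

module Defs where

open import Data.Nat using (ℕ; _+_; _*_; _<_; _≤_)
open import Data.Fin using (Fin; _≟_; _↑ˡ_; _↑ʳ_)
open import Data.Bool using (Bool)
open import Data.Product using (Σ; ∃; _×_; _,_; proj₁; proj₂)
open import Data.Sum using (_⊎_)
open import Data.List using (List; []; _∷_; length; map; filter; _++_; allFin)
open import Data.List.Relation.Unary.All using (All)
open import Data.List.Relation.Unary.Any using (Any)
open import Data.List.Relation.Unary.AllPairs using (AllPairs)
open import Relation.Binary.PropositionalEquality using (_≡_; _≢_)
open import Relation.Nullary using (¬_; Dec)
open import Relation.Nullary.Decidable using (¬?; _×-dec_; _⊎-dec_)
open import Function.Bundles using (_↔_; _⇔_; Inverse)

-- A finite graph: vertex set Fin n, edges given as a list of (unordered) pairs.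
record Graph : Set where
  constructor graph
  field
    n     : ℕ
    edges : List (Fin n × Fin n)
open Graph public

Edge : Graph → Set
Edge G = Fin (n G) × Fin (n G)

SameEdge : {m : ℕ} → Fin m × Fin m → Fin m × Fin m → Set
SameEdge (u , v) (x , y) = (u ≡ x × v ≡ y) ⊎ (u ≡ y × v ≡ x)

sameEdge? : {m : ℕ} (e f : Fin m × Fin m) → Dec (SameEdge e f)
sameEdge? (u , v) (x , y) = ((u ≟ x) ×-dec (v ≟ y)) ⊎-dec ((u ≟ y) ×-dec (v ≟ x))

Shares : {m : ℕ} → Fin m × Fin m → Fin m × Fin m → Set
Shares (u , v) (x , y) = (u ≡ x ⊎ u ≡ y) ⊎ (v ≡ x ⊎ v ≡ y)

shares? : {m : ℕ} (e f : Fin m × Fin m) → Dec (Shares e f)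
shares? (u , v) (x , y) = ((u ≟ x) ⊎-dec (u ≟ y)) ⊎-dec ((v ≟ x) ⊎-dec (v ≟ y))

Simple : Graph → Set
Simple G = All (λ e → proj₁ e ≢ proj₂ e) (edges G)
         × AllPairs (λ e f → ¬ SameEdge e f) (edges G)

Adj : (G : Graph) → Fin (n G) → Fin (n G) → Set
Adj G u v = Any (λ e → SameEdge e (u , v)) (edges G)

Bipartite : Graph → Set
Bipartite G = Σ (Fin (n G) → Bool) λ c → All (λ e → c (proj₁ e) ≢ c (proj₂ e)) (edges G)

NoIsolated : Graph → Set
NoIsolated G = (v : Fin (n G)) → Any (λ e → proj₁ e ≡ v ⊎ proj₂ e ≡ v) (edges G)

S₁ : (G : Graph) → Edge G → List (Edge G)
S₁ G e = filter (λ f → ¬? (sameEdge? f e) ×-dec shares? f e) (edges G)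

_⊕_ : Graph → Graph → Graph
G ⊕ H = graph (n G + n H)
  (map (λ e → (proj₁ e ↑ˡ n H , proj₂ e ↑ˡ n H)) (edges G)
   ++ map (λ e → (n G ↑ʳ proj₁ e , n G ↑ʳ proj₂ e)) (edges H))

H¹ : ℕ → Graph
H¹ m = graph (m + m) (map (λ i → (i ↑ˡ m , m ↑ʳ i)) (allFin m))

Isomorphic : Graph → Graph → Set
Isomorphic G H = Σ (Fin (n G) ↔ Fin (n H)) λ σ →
  (u v : Fin (n G)) → Adj G u v ⇔ Adj H (Inverse.to σ u) (Inverse.to σ v)

-- min_{e ∈ E(G)} |S₁(e)| < |E(G)| - |V(G)|/2   (multiplied by 2; min over
-- a finite set is < X iff some element is < X; empty E(G) makes it false)
MinS₁Below : Graph → Set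
MinS₁Below G = Any (λ e → 2 * length (S₁ G e) + n G < 2 * length (edges G)) (edges G)

MinS₁AtMost : Graph → Set
MinS₁AtMost G = Any (λ e → 2 * length (S₁ G e) + n G ≤ 2 * length (edges G)) (edges G)

{-# OPTIONS --safe #-}
-- Every edge e of H₁ keeps its set S₁(e) in H₁ + H₂, while |E| and |V| are
-- additive, so the slack 2|E(H₁)| − 2|S₁(e)| − |V(H₁)| of H₁ is augmented by
-- the slack 2|E(H₂)| − |V(H₂)| of H₂. Without isolated vertices every vertex
-- is one of the 2|E(H₂)| edge endpoints, so that slack is never negative;
-- and when it is zero the endpoints are pairwise distinct vertices, i.e.
-- H₂ is a perfect matching H¹_{|E(H₂)|}.
module Submission where

open import Defs
open import Data.Nat using (ℕ; suc; _+_; _*_; _≤_; _<_; _<?_)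
open import Data.Nat.Properties
  using (+-assoc; +-identityʳ; *-distribˡ-+; +-mono-<-≤; +-mono-≤-<; ≮⇒≥; <⇒≱; n<1+n; ≤-trans)
open import Data.Fin using (Fin; _↑ˡ_; _↑ʳ_; splitAt; punchOut)
open import Data.Fin.Properties
  using (any?; ↑ˡ-injective; splitAt-↑ˡ; splitAt-↑ʳ; injective⇒≤; punchOut-injective)
  renaming (_≟_ to _≟ᶠ_)
open import Data.Product using (_×_; _,_; proj₁; proj₂)
import Data.Product as Product
open import Data.Sum using (inj₁; inj₂; [_,_]′)
import Data.Sum as Sum
open import Data.List using (List; []; _∷_; length; map; filter; _++_; lookup; tabulate; allFin)
open import Data.List.Properties
  using (filter-++; filter-≐; filter-none; ++-identityʳ; length-++; length-map;
         map-tabulate; tabulate-cong; tabulate-lookup)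
open import Data.List.Relation.Unary.All using (All; universal)
import Data.List.Relation.Unary.All.Properties as All
open import Data.List.Relation.Unary.Any using (Any; index)
import Data.List.Relation.Unary.Any as Any
import Data.List.Relation.Unary.Any.Properties as Any
open import Data.List.Relation.Unary.Any.Properties using (lookup-index)
open import Function using (_∘_)
open import Function.Bundles using (_↔_; Inverse; Injection; mk⇔; mk↔ₛ′)
open import Function.Definitions using (Injective; StrictlySurjective)
open import Function.Properties.Inverse using (↔⇒↣)
open import Relation.Nullary using (¬_; yes; no; contradiction)
open import Relation.Nullary.Decidable using (¬?; _×-dec_)
open import Relation.Unary using (Pred; Decidable)
open import Relation.Binary.PropositionalEquality

size : Graph → ℕ
size G = length (edges G)

filter-map : ∀ {a b p} {A : Set a} {B : Set b} {P : Pred B p}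
             (P? : Decidable P) (f : A → B) (xs : List A) →
             filter P? (map f xs) ≡ map f (filter (P? ∘ f) xs)
filter-map P? f []       = refl
filter-map P? f (x ∷ xs) with P? (f x)
... | yes _ = cong (f x ∷_) (filter-map P? f xs)
... | no  _ = filter-map P? f xs

injective⇒strictlySurjective : ∀ {m n} {f : Fin m → Fin n} → n ≤ m →
                               Injective _≡_ _≡_ f → StrictlySurjective _≡_ f
injective⇒strictlySurjective {m} {suc n} {f} n≤m f-injective y with any? (λ x → f x ≟ᶠ y)
... | yes hit  = hit
... | no  miss = contradiction (≤-trans n≤m (injective⇒≤ punchOut-injective′)) (<⇒≱ (n<1+n n))
  where
  y≢f : ∀ x → y ≢ f x
  y≢f x y≡fx = miss (x , sym y≡fx)

  punchOut-injective′ : Injective _≡_ _≡_ (λ x → punchOut (y≢f x))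
  punchOut-injective′ {x} {x′} = f-injective ∘ punchOut-injective (y≢f x) (y≢f x′)

relabel : ∀ {k l} → (Fin k → Fin l) → Fin k × Fin k → Fin l × Fin l
relabel φ = Product.map φ φ

module _ {k l} {φ : Fin k → Fin l} where

  sameEdge-relabel⁺ : ∀ {e f} → SameEdge e f → SameEdge (relabel φ e) (relabel φ f)
  sameEdge-relabel⁺ = Sum.map (Product.map (cong φ) (cong φ)) (Product.map (cong φ) (cong φ))

  shares-relabel⁺ : ∀ {e f} → Shares e f → Shares (relabel φ e) (relabel φ f)
  shares-relabel⁺ = Sum.map (Sum.map (cong φ) (cong φ)) (Sum.map (cong φ) (cong φ))

  module _ (φ-injective : Injective _≡_ _≡_ φ) where

    sameEdge-relabel⁻ : ∀ {e f} → SameEdge (relabel φ e) (relabel φ f) → SameEdge e f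
    sameEdge-relabel⁻ =
      Sum.map (Product.map φ-injective φ-injective) (Product.map φ-injective φ-injective)

    shares-relabel⁻ : ∀ {e f} → Shares (relabel φ e) (relabel φ f) → Shares e f
    shares-relabel⁻ = Sum.map (Sum.map φ-injective φ-injective) (Sum.map φ-injective φ-injective)

relabel-isomorphic : (G : Graph) {k : ℕ} (σ : Fin (n G) ↔ Fin k) →
                     Isomorphic G (graph k (map (relabel (Inverse.to σ)) (edges G)))
relabel-isomorphic G σ = σ , λ u v →
  mk⇔ (Any.map⁺ ∘ Any.map sameEdge-relabel⁺)
      (Any.map (sameEdge-relabel⁻ (Injection.injective (↔⇒↣ σ))) ∘ Any.map⁻)

↑ʳ≢↑ˡ : ∀ {k l} (i : Fin l) (j : Fin k) → k ↑ʳ i ≢ j ↑ˡ l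
↑ʳ≢↑ˡ {k} {l} i j eq = contradiction splitAt-agrees λ ()
  where
  splitAt-agrees : inj₂ i ≡ inj₁ j
  splitAt-agrees = begin
    inj₂ i             ≡⟨ splitAt-↑ʳ k l i ⟨
    splitAt k (k ↑ʳ i) ≡⟨ cong (splitAt k) eq ⟩
    splitAt k (j ↑ˡ l) ≡⟨ splitAt-↑ˡ k j l ⟩
    inj₁ j             ∎
    where open ≡-Reasoning

module _ (G H : Graph) where

  private
    inl : Edge G → Edge (G ⊕ H)
    inl = relabel (_↑ˡ n H)

    inr : Edge H → Edge (G ⊕ H)
    inr = relabel (n G ↑ʳ_)

  ¬shares-inr-inl : ∀ f e → ¬ Shares (inr f) (inl e)
  ¬shares-inr-inl f e = Sum.[ Sum.[ ↑ʳ≢↑ˡ _ _ , ↑ʳ≢↑ˡ _ _ ]′ , Sum.[ ↑ʳ≢↑ˡ _ _ , ↑ʳ≢↑ˡ _ _ ]′ ]′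

  S₁-⊕-inl : ∀ e → S₁ (G ⊕ H) (inl e) ≡ map inl (S₁ G e)
  S₁-⊕-inl e = begin
    filter P? (map inl (edges G) ++ map inr (edges H))
      ≡⟨ filter-++ P? (map inl (edges G)) (map inr (edges H)) ⟩
    filter P? (map inl (edges G)) ++ filter P? (map inr (edges H))
      ≡⟨ cong₂ _++_ (filter-map P? inl (edges G)) (filter-none P? noneFromH) ⟩
    map inl (filter (P? ∘ inl) (edges G)) ++ []
      ≡⟨ ++-identityʳ _ ⟩
    map inl (filter (P? ∘ inl) (edges G))
      ≡⟨ cong (map inl) (filter-≐ (P? ∘ inl) Q? (restrict , extend) (edges G)) ⟩
    map inl (S₁ G e) ∎
    where
    open ≡-Reasoning

    P? : Decidable (λ f → ¬ SameEdge f (inl e) × Shares f (inl e))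
    P? f = ¬? (sameEdge? f (inl e)) ×-dec shares? f (inl e)

    Q? : Decidable (λ f → ¬ SameEdge f e × Shares f e)
    Q? f = ¬? (sameEdge? f e) ×-dec shares? f e

    inl-injective : Injective _≡_ _≡_ (_↑ˡ n H)
    inl-injective = ↑ˡ-injective (n H) _ _

    noneFromH : All (λ f → ¬ (¬ SameEdge f (inl e) × Shares f (inl e))) (map inr (edges H))
    noneFromH = All.map⁺ (universal (λ f → ¬shares-inr-inl f e ∘ proj₂) (edges H))

    restrict : ∀ {f} → ¬ SameEdge (inl f) (inl e) × Shares (inl f) (inl e) →
                       ¬ SameEdge f e × Shares f e
    restrict (¬same , shares) = ¬same ∘ sameEdge-relabel⁺ , shares-relabel⁻ inl-injective shares

    extend : ∀ {f} → ¬ SameEdge f e × Shares f e →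
                     ¬ SameEdge (inl f) (inl e) × Shares (inl f) (inl e)
    extend (¬same , shares) = ¬same ∘ sameEdge-relabel⁻ inl-injective , shares-relabel⁺ shares

  size-⊕ : size (G ⊕ H) ≡ size G + size H
  size-⊕ = trans (length-++ (map inl (edges G)))
                 (cong₂ _+_ (length-map inl (edges G)) (length-map inr (edges H)))

  minS₁Below-⊕ : ∀ {p} {P : Pred (Edge G) p} →
                 (∀ {e} → P e → 2 * length (S₁ G e) + n G + n H < 2 * size G + 2 * size H) →
                 Any P (edges G) → MinS₁Below (G ⊕ H)
  minS₁Below-⊕ bound =
    Any.++⁺ˡ ∘ Any.map⁺ ∘ Any.map (λ {e} → subst₂ _<_ (S₁-term e) size-term ∘ bound)
    where
    open ≡-Reasoning

    S₁-term : ∀ e → 2 * length (S₁ G e) + n G + n H ≡ 2 * length (S₁ (G ⊕ H) (inl e)) + n (G ⊕ H)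
    S₁-term e = begin
      2 * length (S₁ G e) + n G + n H
        ≡⟨ +-assoc _ (n G) (n H) ⟩
      2 * length (S₁ G e) + n (G ⊕ H)
        ≡⟨ cong (λ s → 2 * s + n (G ⊕ H)) (length-map inl (S₁ G e)) ⟨
      2 * length (map inl (S₁ G e)) + n (G ⊕ H)
        ≡⟨ cong (λ es → 2 * length es + n (G ⊕ H)) (S₁-⊕-inl e) ⟨
      2 * length (S₁ (G ⊕ H) (inl e)) + n (G ⊕ H) ∎

    size-term : 2 * size G + 2 * size H ≡ 2 * size (G ⊕ H)
    size-term = begin
      2 * size G + 2 * size H   ≡⟨ *-distribˡ-+ 2 (size G) (size H) ⟨
      2 * (size G + size H)     ≡⟨ cong (2 *_) size-⊕ ⟨
      2 * size (G ⊕ H)          ∎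

module Endpoints (G : Graph) where

  private
    m : ℕ
    m = size G

    E : List (Edge G)
    E = edges G

  -- Slot i ↑ˡ m is the first endpoint of edge i and m ↑ʳ i its second, as in H¹ m.
  endpoint : Fin (m + m) → Fin (n G)
  endpoint = [ proj₁ ∘ lookup E , proj₂ ∘ lookup E ]′ ∘ splitAt m

  endpoint-↑ˡ : ∀ i → endpoint (i ↑ˡ m) ≡ proj₁ (lookup E i)
  endpoint-↑ˡ i = cong [ proj₁ ∘ lookup E , proj₂ ∘ lookup E ]′ (splitAt-↑ˡ m i m)

  endpoint-↑ʳ : ∀ i → endpoint (m ↑ʳ i) ≡ proj₂ (lookup E i)
  endpoint-↑ʳ i = cong [ proj₁ ∘ lookup E , proj₂ ∘ lookup E ]′ (splitAt-↑ʳ m m i)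

  module _ (noIsolated : NoIsolated G) where

    slot : ∀ {v} i → proj₁ (lookup E i) ≡ v Sum.⊎ proj₂ (lookup E i) ≡ v → Fin (m + m)
    slot i (inj₁ _) = i ↑ˡ m
    slot i (inj₂ _) = m ↑ʳ i

    endpoint-slot : ∀ {v} i incident → endpoint (slot {v} i incident) ≡ v
    endpoint-slot i (inj₁ eq) = trans (endpoint-↑ˡ i) eq
    endpoint-slot i (inj₂ eq) = trans (endpoint-↑ʳ i) eq

    position : Fin (n G) → Fin (m + m)
    position v = slot (index (noIsolated v)) (lookup-index (noIsolated v))

    endpoint-position : ∀ v → endpoint (position v) ≡ v
    endpoint-position v = endpoint-slot (index (noIsolated v)) (lookup-index (noIsolated v))

    position-injective : Injective _≡_ _≡_ position
    position-injective {u} {v} eq = begin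
      u                     ≡⟨ endpoint-position u ⟨
      endpoint (position u) ≡⟨ cong endpoint eq ⟩
      endpoint (position v) ≡⟨ endpoint-position v ⟩
      v                     ∎
      where open ≡-Reasoning

    module _ (m+m≤n : m + m ≤ n G) where

      position-endpoint : ∀ p → position (endpoint p) ≡ p
      position-endpoint p with v , refl ← injective⇒strictlySurjective m+m≤n position-injective p =
        cong position (endpoint-position v)

      relabel-lookup : ∀ i → relabel position (lookup E i) ≡ (i ↑ˡ m , m ↑ʳ i)
      relabel-lookup i = cong₂ _,_
        (trans (cong position (sym (endpoint-↑ˡ i))) (position-endpoint (i ↑ˡ m)))
        (trans (cong position (sym (endpoint-↑ʳ i))) (position-endpoint (m ↑ʳ i)))

      edges-H¹ : edges (H¹ m) ≡ map (relabel position) E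
      edges-H¹ = begin
        map (λ i → (i ↑ˡ m , m ↑ʳ i)) (allFin m)
          ≡⟨ map-tabulate (λ i → i) _ ⟩
        tabulate (λ i → (i ↑ˡ m , m ↑ʳ i))
          ≡⟨ tabulate-cong relabel-lookup ⟨
        tabulate (relabel position ∘ lookup E)
          ≡⟨ map-tabulate (lookup E) (relabel position) ⟨
        map (relabel position) (tabulate (lookup E))
          ≡⟨ cong (map (relabel position)) (tabulate-lookup E) ⟩
        map (relabel position) E ∎
        where open ≡-Reasoning

      isomorphic-H¹ : Isomorphic G (H¹ m)
      isomorphic-H¹ = subst (Isomorphic G) (cong (graph (m + m)) (sym edges-H¹))
        (relabel-isomorphic G (mk↔ₛ′ position endpoint position-endpoint endpoint-position))

2*n≡n+n : ∀ k → 2 * k ≡ k + k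
2*n≡n+n k = cong (k +_) (+-identityʳ k)

noIsolated⇒n≤2*size : ∀ G → NoIsolated G → n G ≤ 2 * size G
noIsolated⇒n≤2*size G noIsolated =
  subst (n G ≤_) (sym (2*n≡n+n (size G))) (injective⇒≤ (position-injective noIsolated))
  where open Endpoints G

noIsolated∧2*size≤n⇒isomorphic-H¹ : ∀ G → NoIsolated G → 2 * size G ≤ n G →
                                     Isomorphic G (H¹ (size G))
noIsolated∧2*size≤n⇒isomorphic-H¹ G noIsolated 2m≤n =
  isomorphic-H¹ noIsolated (subst (_≤ n G) (2*n≡n+n (size G)) 2m≤n)
  where open Endpoints G

corollary3p6 : (H₁ H₂ : Graph)
    → Simple H₁ → Simple H₂
    → Bipartite H₁ → Bipartite H₂
    → NoIsolated H₁ → NoIsolated H₂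
    → (MinS₁Below H₁ → MinS₁Below (H₁ ⊕ H₂))
      × (¬ Isomorphic H₂ (H¹ (length (edges H₂))) → MinS₁AtMost H₁ → MinS₁Below (H₁ ⊕ H₂))
corollary3p6 H₁ H₂ _ _ _ _ _ noIsolated₂ = below , atMost
  where
  below : MinS₁Below H₁ → MinS₁Below (H₁ ⊕ H₂)
  below = minS₁Below-⊕ H₁ H₂ (λ e-below → +-mono-<-≤ e-below (noIsolated⇒n≤2*size H₂ noIsolated₂))

  atMost : ¬ Isomorphic H₂ (H¹ (size H₂)) → MinS₁AtMost H₁ → MinS₁Below (H₁ ⊕ H₂)
  atMost ¬H¹ with n H₂ <? 2 * size H₂
  ... | yes n<2m = minS₁Below-⊕ H₁ H₂ (λ e-atMost → +-mono-≤-< e-atMost n<2m)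
  ... | no  n≮2m = contradiction (noIsolated∧2*size≤n⇒isomorphic-H¹ H₂ noIsolated₂ (≮⇒≥ n≮2m)) ¬H¹
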